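{- Let $G$ be a connected finite $\delta$-hyperbolic graph and let $P(y,x)=(y=v_0,v_1,\dots,v_p=x)$ be an end-minimal shortest path from $y$ to $x$. (i) Any up-hill $(u,\dots,v)$ of $P(y,x)$ has height $d(u,v)\le\delta$. (ii) Any $c\in P(y,x)$ with $d(c,x)>2\delta$ satisfies $e(c)\le e(y)+\delta$ and $e(c)\le e(y)-d(c,y)+2\delta$. (iii) If $d(y,x)>4\delta+1$, then every vertex $v_i$ of $P(y,x)$ with $i\in[2\delta+1,p-2\delta-1]$ satisfies $e(v_i)<\min\{e(v_k): k\in[0,i-2\delta-1]\}$.
   Context: $G$ is $\delta$-hyperbolic if for any four vertices $u,v,w,x$ the two larger of $d(u,v)+d(w,x)$, $d(u,w)+d(v,x)$, $d(u,x)+d(v,w)$ differ by at most $2\delta$ ($d$ = shortest-path distance). $e(v)=\max_u d(v,u)$. A shortest path $P(y,x)$ from $y$ to $x$ is end-minimal if $e(x)\le e(v)$ for all $v\in P(y,x)$. An up-hill on $P(y,x)$ is a maximal by inclusion subpath $(v_i,\dots,v_{i+\ell})$ with $e(v_{j+1})>e(v_j)$ for all $j\in\{i,\dots,i+\ell-1\}$; $\ell$ is its height. -}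

module Defs where

open import Data.Nat using (ℕ; zero; suc; _+_; _*_; _∸_; _≤_; _<_; _⊔_; _⊓_)
open import Data.Fin using (Fin; _≟_)
open import Data.Bool using (Bool; true; false; T; _∨_; _∧_; if_then_else_)
open import Data.List using (List; allFin; foldr)
open import Data.Bool.ListAction using (any)
open import Data.Product using (Σ; ∃; _×_)
open import Relation.Nullary.Decidable using (⌊_⌋)
open import Relation.Binary.PropositionalEquality using (_≡_)
open import Function using (_∘_)

record Graph : Set where
  field
    n     : ℕ
    adj   : Fin n → Fin n → Bool
    sym   : ∀ u v → adj u v ≡ adj v u
    irrefl : ∀ u → adj u u ≡ false

module _ (G : Graph) where
  open Graph G

  reach : ℕ → Fin n → Fin n → Bool
  reach zero    u v = ⌊ u ≟ v ⌋
  reach (suc k) u v = reach k u v ∨ any (λ w → reach k u w ∧ adj w v) (allFin n)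

  data Walk : Fin n → Fin n → ℕ → Set where
    here : ∀ {u} → Walk u u 0
    step : ∀ {u v w k} → T (adj u v) → Walk v w k → Walk u w (suc k)

  Connected : Set
  Connected = ∀ u v → ∃ λ k → Walk u v k

-- least k < m with f k = true, or m if none
firstTrue : (ℕ → Bool) → ℕ → ℕ
firstTrue f zero    = zero
firstTrue f (suc m) = if f 0 then 0 else suc (firstTrue (f ∘ suc) m)

module _ (G : Graph) where
  open Graph G

  -- shortest-path distance (length of a shortest walk; any connected
  -- graph on n vertices has all distances < n)
  dist : Fin n → Fin n → ℕ
  dist u v = firstTrue (λ k → reach G k u v) n

  ecc : Fin n → ℕ
  ecc v = foldr (λ u m → dist v u ⊔ m) 0 (allFin n)

  med3 : ℕ → ℕ → ℕ → ℕ
  med3 a b c = (a ⊓ b) ⊔ ((a ⊔ b) ⊓ c)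

  -- four-point condition with h = 2δ: the two larger of the three sums
  -- differ by at most h
  Hyperbolic : (h : ℕ) → Set
  Hyperbolic h = ∀ u v w x →
    let s₁ = dist u v + dist w x
        s₂ = dist u w + dist v x
        s₃ = dist u x + dist v w
    in (s₁ ⊔ (s₂ ⊔ s₃)) ≤ med3 s₁ s₂ s₃ + h

  IsShortestPath : (P : ℕ → Fin n) (p : ℕ) (y x : Fin n) → Set
  IsShortestPath P p y x =
    P 0 ≡ y × P p ≡ x × (∀ i → i < p → T (adj (P i) (P (suc i)))) × p ≡ dist y x

  EndMinimal : (P : ℕ → Fin n) (p : ℕ) → Set
  EndMinimal P p = ∀ i → i ≤ p → ecc (P p) ≤ ecc (P i)

  -- (P i, ..., P (i + ℓ)) is an up-hill of P (of height ℓ): strictly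
  -- increasing eccentricities, maximal by inclusion
  UpHill : (P : ℕ → Fin n) (p i ℓ : ℕ) → Set
  UpHill P p i ℓ =
    i + ℓ ≤ p ×
    (∀ j → i ≤ j → j < i + ℓ → ecc (P j) < ecc (P (suc j))) ×
    (∀ j → i ≡ suc j → ecc (P i) ≤ ecc (P j)) ×
    (i + ℓ < p → ecc (P (suc (i + ℓ))) ≤ ecc (P (i + ℓ)))

-- Everything rests on one application of the four-point condition to a vertex u of the
-- geodesic, a later vertex v, its end x, and a vertex w realising e(v): either
-- d(v,x) + e(v) ≤ e(x) + 2δ or d(u,v) + e(v) ≤ e(u) + 2δ. End-minimality rules out the
-- first alternative as soon as d(v,x) > 2δ, which gives (ii) and (iii). Along an up-hill
-- e climbs by at least d(u,v), and then either alternative forces 2 d(u,v) ≤ 2δ, which is (i).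
module Submission where

open import Defs
open import Data.Nat using (ℕ; suc; _+_; _*_; _∸_; _≤_; _<_)
open import Data.Fin using (Fin)
open import Data.Product using (_×_)
open import Relation.Binary.PropositionalEquality using (_≡_)

open import Data.Bool using (true; false; T)
open import Data.Bool.Properties using (T-∨; T-∧)
open import Data.Empty using (⊥-elim)
open import Data.List using ([]; _∷_; allFin; foldr)
open import Data.List.Membership.Propositional using (_∈_; lose)
open import Data.List.Membership.Propositional.Properties using (∈-allFin)
open import Data.List.Relation.Unary.Any using (here; there; satisfied)
open import Data.List.Relation.Unary.Any.Properties using (any⁺; any⁻)
open import Data.Nat using (zero; _⊔_; _⊓_; z≤n; s≤s; _<?_)
open import Data.Nat.Properties
open import Algebra.Properties.CommutativeSemigroup +-commutativeSemigroup using (xy∙z≈xz∙y)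
open import Data.Nat.Tactic.RingSolver using (solve-∀)
open import Data.Product using (∃; _,_; proj₁; proj₂)
open import Data.Sum using (_⊎_; inj₁; inj₂; [_,_]′)
import Data.Sum as Sum
open import Function using (_∘_; Equivalence)
open import Relation.Nullary using (yes; no)
open import Relation.Nullary.Decidable using (toWitness; fromWitness)
open import Relation.Binary.PropositionalEquality using (refl; sym; trans; cong; cong₂; subst)
open Equivalence using (to; from)
open ≤-Reasoning

firstTrue-least : ∀ f m k → T (f k) → firstTrue f m ≤ k
firstTrue-least f zero    k       _ = z≤n
firstTrue-least f (suc m) k       t with f 0 in f0
... | true = z≤n
firstTrue-least f (suc m) zero    t | false rewrite f0 = ⊥-elim t
firstTrue-least f (suc m) (suc k) t | false = s≤s (firstTrue-least (f ∘ suc) m k t)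

firstTrue-≤ : ∀ f m → firstTrue f m ≤ m
firstTrue-≤ f zero = z≤n
firstTrue-≤ f (suc m) with f 0
... | true  = z≤n
... | false = s≤s (firstTrue-≤ (f ∘ suc) m)

firstTrue-sound : ∀ f m → firstTrue f m < m → T (f (firstTrue f m))
firstTrue-sound f (suc m) _ with f 0 in f0
... | true rewrite f0 = _
firstTrue-sound f (suc m) (s≤s lt) | false = firstTrue-sound (f ∘ suc) m lt

module _ {A : Set} (g : A → ℕ) where

  ≤-foldr-⊔ : ∀ {x xs} → x ∈ xs → g x ≤ foldr (λ u m → g u ⊔ m) 0 xs
  ≤-foldr-⊔ {xs = y ∷ xs} (here refl) = m≤m⊔n (g y) _
  ≤-foldr-⊔ {xs = y ∷ xs} (there x∈xs) = ≤-trans (≤-foldr-⊔ x∈xs) (m≤n⊔m (g y) _)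

  foldr-⊔-sel : ∀ xs → foldr (λ u m → g u ⊔ m) 0 xs ≡ 0
                     ⊎ ∃ λ u → foldr (λ u m → g u ⊔ m) 0 xs ≡ g u
  foldr-⊔-sel []       = inj₁ refl
  foldr-⊔-sel (y ∷ xs) with ⊔-sel (g y) (foldr (λ u m → g u ⊔ m) 0 xs)
  ... | inj₁ eq = inj₂ (y , eq)
  ... | inj₂ eq = Sum.map (trans eq) (λ (u , eq′) → u , trans eq eq′) (foldr-⊔-sel xs)

strictly-increasing⇒+-≤ : ∀ (f : ℕ → ℕ) i ℓ → (∀ j → i ≤ j → j < i + ℓ → f j < f (suc j)) →
                          f i + ℓ ≤ f (i + ℓ)
strictly-increasing⇒+-≤ f i zero _ =
  ≤-reflexive (trans (+-identityʳ (f i)) (cong f (sym (+-identityʳ i))))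
strictly-increasing⇒+-≤ f i (suc ℓ) increasing = begin
  f i + suc ℓ        ≡⟨ +-suc (f i) ℓ ⟩
  suc (f i + ℓ)      ≤⟨ s≤s (strictly-increasing⇒+-≤ f i ℓ λ j i≤j j<i+ℓ →
                           increasing j i≤j (≤-trans j<i+ℓ (+-monoʳ-≤ i (n≤1+n ℓ)))) ⟩
  suc (f (i + ℓ))    ≤⟨ increasing (i + ℓ) (m≤m+n i ℓ) (+-monoʳ-< i (n<1+n ℓ)) ⟩
  f (suc (i + ℓ))    ≡⟨ cong f (+-suc i ℓ) ⟨
  f (i + suc ℓ)      ∎

m+[h+1]≤n⇒h<n∸m : ∀ m {h n} → m + (h + 1) ≤ n → h < n ∸ m
m+[h+1]≤n⇒h<n∸m m {h} {n} le =
  subst (_≤ n ∸ m) (+-comm h 1) (m+n≤o⇒m≤o∸n (h + 1) (subst (_≤ n) (+-comm m (h + 1)) le))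

m+n≤o+h∧h<n⇒m<o : ∀ {m n o h} → h < n → m + n ≤ o + h → m < o
m+n≤o+h∧h<n⇒m<o {m} {n} {o} {h} h<n le = +-cancelʳ-≤ h (suc m) o (begin
  suc m + h    ≡⟨ +-suc m h ⟨
  m + suc h    ≤⟨ +-monoʳ-≤ m h<n ⟩
  m + n        ≤⟨ le ⟩
  o + h        ∎)

m+n≤o+h∧m≤n+o⇒2m≤2o+h : ∀ m n o h → m + n ≤ o + h → m ≤ n + o → 2 * m ≤ 2 * o + h
m+n≤o+h∧m≤n+o⇒2m≤2o+h m n o h m+n≤o+h m≤n+o = +-cancelˡ-≤ n (2 * m) (2 * o + h) (begin
  n + 2 * m          ≡⟨ left m n ⟩
  m + n + m          ≤⟨ +-mono-≤ m+n≤o+h m≤n+o ⟩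
  o + h + (n + o)    ≡⟨ right n o h ⟩
  n + (2 * o + h)    ∎)
  where
  left : ∀ m n → n + 2 * m ≡ m + n + m
  left = solve-∀
  right : ∀ n o h → o + h + (n + o) ≡ n + (2 * o + h)
  right = solve-∀

module Distance (G : Graph) where
  open Graph G using (n; adj)

  reach-refl : ∀ u → T (reach G 0 u u)
  reach-refl u = fromWitness refl

  reach-weaken : ∀ k {u v} → T (reach G k u v) → T (reach G (suc k) u v)
  reach-weaken k r = from T-∨ (inj₁ r)

  reach-extend : ∀ k {u w v} → T (reach G k u w) → T (adj w v) → T (reach G (suc k) u v)
  reach-extend k {u} {w} {v} r a =
    from T-∨ (inj₂ (any⁺ _ (lose (∈-allFin w) (from (T-∧ {reach G k u w} {adj w v}) (r , a)))))

  reach-suc-inv : ∀ k {u v} → T (reach G (suc k) u v) →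
                  T (reach G k u v) ⊎ ∃ λ w → T (reach G k u w) × T (adj w v)
  reach-suc-inv k {u} {v} r with to T-∨ r
  ... | inj₁ r′ = inj₁ r′
  ... | inj₂ r′ with satisfied (any⁻ _ (allFin n) r′)
  ... | w , rw = inj₂ (w , to (T-∧ {reach G k u w} {adj w v}) rw)

  adj⇒reach-1 : ∀ {u v} → T (adj u v) → T (reach G 1 u v)
  adj⇒reach-1 {u} = reach-extend 0 (reach-refl u)

  reach-trans : ∀ k m {u v w} → T (reach G k u v) → T (reach G m v w) → T (reach G (k + m) u w)
  reach-trans k zero r₁ r₂ rewrite toWitness r₂ | +-identityʳ k = r₁
  reach-trans k (suc m) r₁ r₂ rewrite +-suc k m with reach-suc-inv m r₂
  ... | inj₁ r = reach-weaken (k + m) (reach-trans k m r₁ r)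
  ... | inj₂ (_ , r , a) = reach-extend (k + m) (reach-trans k m r₁ r) a

  reach-sym : ∀ k {u v} → T (reach G k u v) → T (reach G k v u)
  reach-sym zero r rewrite toWitness r = reach-refl _
  reach-sym (suc k) r with reach-suc-inv k r
  ... | inj₁ r′ = reach-weaken k (reach-sym k r′)
  ... | inj₂ (w , r′ , a) = reach-trans 1 k (adj⇒reach-1 (subst T (Graph.sym G w _) a)) (reach-sym k r′)

  walk⇒reach : ∀ {u v k} → Walk G u v k → T (reach G k u v)
  walk⇒reach here             = reach-refl _
  walk⇒reach (step {k = k} a w) = reach-trans 1 k (adj⇒reach-1 a) (walk⇒reach w)

  dist-least : ∀ k {u v} → T (reach G k u v) → dist G u v ≤ k
  dist-least k {u} {v} = firstTrue-least (λ j → reach G j u v) n k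

  dist-≤-n : ∀ u v → dist G u v ≤ n
  dist-≤-n u v = firstTrue-≤ (λ j → reach G j u v) n

  dist-attained : ∀ u v → dist G u v < n → T (reach G (dist G u v) u v)
  dist-attained u v = firstTrue-sound (λ j → reach G j u v) n

  dist-≤-walk : ∀ {u v k} → Walk G u v k → dist G u v ≤ k
  dist-≤-walk {k = k} w = dist-least k (walk⇒reach w)

  -- Pairs without a walk of length < n get the junk distance n; as the largest value dist
  -- takes, it keeps dist symmetric and subadditive on any graph, connected or not.
  dist-sym≤ : ∀ u v → dist G u v ≤ dist G v u
  dist-sym≤ u v with dist G v u <? n
  ... | yes d<n = dist-least (dist G v u) (reach-sym (dist G v u) (dist-attained v u d<n))
  ... | no  d≮n = ≤-trans (dist-≤-n u v) (≮⇒≥ d≮n)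

  dist-sym : ∀ u v → dist G u v ≡ dist G v u
  dist-sym u v = ≤-antisym (dist-sym≤ u v) (dist-sym≤ v u)

  dist-triangle : ∀ u v w → dist G u w ≤ dist G u v + dist G v w
  dist-triangle u v w with dist G u v <? n | dist G v w <? n
  ... | yes d₁<n | yes d₂<n = dist-least (dist G u v + dist G v w)
          (reach-trans (dist G u v) (dist G v w) (dist-attained u v d₁<n) (dist-attained v w d₂<n))
  ... | no  d₁≮n | _        = ≤-trans (dist-≤-n u w) (≤-trans (≮⇒≥ d₁≮n) (m≤m+n _ _))
  ... | yes _    | no  d₂≮n = ≤-trans (dist-≤-n u w) (≤-trans (≮⇒≥ d₂≮n) (m≤n+m _ _))

  dist-≤-ecc : ∀ v u → dist G v u ≤ ecc G v
  dist-≤-ecc v u = ≤-foldr-⊔ (dist G v) (∈-allFin u)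

  ecc-attained : ∀ v → ∃ λ w → ecc G v ≤ dist G v w
  ecc-attained v with foldr-⊔-sel (dist G v) (allFin n)
  ... | inj₁ e≡0       = v , ≤-trans (≤-reflexive e≡0) z≤n
  ... | inj₂ (w , e≡d) = w , ≤-reflexive e≡d

  ecc-lipschitz : ∀ u v → ecc G u ≤ dist G u v + ecc G v
  ecc-lipschitz u v with ecc-attained u
  ... | w , eu≤ = begin
    ecc G u                  ≤⟨ eu≤ ⟩
    dist G u w               ≤⟨ dist-triangle u v w ⟩
    dist G u v + dist G v w  ≤⟨ +-monoʳ-≤ (dist G u v) (dist-≤-ecc v w) ⟩
    dist G u v + ecc G v     ∎

  med3-≤ : ∀ a b c → med3 G a b c ≤ a ⊎ med3 G a b c ≤ c
  med3-≤ a b c with ⊔-sel (a ⊓ b) ((a ⊔ b) ⊓ c)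
  ... | inj₁ eq = inj₁ (≤-trans (≤-reflexive eq) (m⊓n≤m a b))
  ... | inj₂ eq = inj₂ (≤-trans (≤-reflexive eq) (m⊓n≤n (a ⊔ b) c))

  module _ {h : ℕ} (H : Hyperbolic G h) where

    four-point : ∀ u v w x →
      dist G u w + dist G v x ≤ dist G u v + dist G w x + h ⊎
      dist G u w + dist G v x ≤ dist G u x + dist G v w + h
    four-point u v w x =
      Sum.map (λ med≤s₁ → ≤-trans s₂≤max (+-monoˡ-≤ h med≤s₁))
              (λ med≤s₃ → ≤-trans s₂≤max (+-monoˡ-≤ h med≤s₃))
              (med3-≤ s₁ s₂ s₃)
      where
      s₁ = dist G u v + dist G w x
      s₂ = dist G u w + dist G v x
      s₃ = dist G u x + dist G v w
      s₂≤max : s₂ ≤ med3 G s₁ s₂ s₃ + h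
      s₂≤max = ≤-trans (≤-trans (m≤m⊔n s₂ s₃) (m≤n⊔m s₁ _)) (H u v w x)

    geodesic-four-point : ∀ {u v x} → dist G u x ≡ dist G u v + dist G v x →
      dist G v x + ecc G v ≤ ecc G x + h ⊎ dist G u v + ecc G v ≤ ecc G u + h
    geodesic-four-point {u} {v} {x} geodesic with ecc-attained v
    ... | w , ev≤ with four-point u v x w
    ... | inj₁ le = inj₁ (+-cancelˡ-≤ (dist G u v) _ _ (begin
      dist G u v + (dist G v x + ecc G v)  ≡⟨ +-assoc (dist G u v) _ _ ⟨
      dist G u v + dist G v x + ecc G v    ≤⟨ uv+vx+ev≤ ⟩
      dist G u x + dist G v w              ≤⟨ le ⟩
      dist G u v + dist G x w + h          ≤⟨ +-monoˡ-≤ h (+-monoʳ-≤ (dist G u v) (dist-≤-ecc x w)) ⟩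
      dist G u v + ecc G x + h             ≡⟨ +-assoc (dist G u v) _ _ ⟩
      dist G u v + (ecc G x + h)           ∎))
      where
      uv+vx+ev≤ : dist G u v + dist G v x + ecc G v ≤ dist G u x + dist G v w
      uv+vx+ev≤ = subst (λ m → m + ecc G v ≤ dist G u x + dist G v w) geodesic
                        (+-monoʳ-≤ (dist G u x) ev≤)
    ... | inj₂ le = inj₂ (+-cancelʳ-≤ (dist G v x) _ _ (begin
      dist G u v + ecc G v + dist G v x    ≡⟨ xy∙z≈xz∙y (dist G u v) _ _ ⟩
      dist G u v + dist G v x + ecc G v    ≡⟨ cong (_+ ecc G v) geodesic ⟨
      dist G u x + ecc G v                 ≤⟨ +-monoʳ-≤ (dist G u x) ev≤ ⟩
      dist G u x + dist G v w              ≤⟨ le ⟩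
      dist G u w + dist G v x + h          ≤⟨ +-monoˡ-≤ h (+-monoˡ-≤ (dist G v x) (dist-≤-ecc u w)) ⟩
      ecc G u + dist G v x + h             ≡⟨ xy∙z≈xz∙y (ecc G u) _ _ ⟩
      ecc G u + h + dist G v x             ∎))

    ecc-descent : ∀ {u v x} → dist G u x ≡ dist G u v + dist G v x → ecc G x ≤ ecc G v →
                  h < dist G v x → ecc G v + dist G v u ≤ ecc G u + h
    ecc-descent {u} {v} {x} geodesic ex≤ev far with geodesic-four-point geodesic
    ... | inj₁ le = ⊥-elim (<⇒≱ far (+-cancelʳ-≤ (ecc G v) _ _ (begin
      dist G v x + ecc G v  ≤⟨ le ⟩
      ecc G x + h           ≤⟨ +-monoˡ-≤ h ex≤ev ⟩
      ecc G v + h           ≡⟨ +-comm (ecc G v) h ⟩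
      h + ecc G v           ∎)))
    ... | inj₂ le = begin
      ecc G v + dist G v u  ≡⟨ +-comm (ecc G v) _ ⟩
      dist G v u + ecc G v  ≡⟨ cong (_+ ecc G v) (dist-sym v u) ⟩
      dist G u v + ecc G v  ≤⟨ le ⟩
      ecc G u + h           ∎

    ecc-ascent-bound : ∀ {u v x} → dist G u x ≡ dist G u v + dist G v x → ecc G x ≤ ecc G u →
                       ecc G u + dist G u v ≤ ecc G v → 2 * dist G u v ≤ h
    ecc-ascent-bound {u} {v} {x} geodesic ex≤eu climb =
      [ twice-climb≤h climb≤vx ex≤eu , twice-climb≤h ≤-refl ≤-refl ]′ (geodesic-four-point geodesic)
      where
      ℓ = dist G u v

      climb≤vx : ℓ ≤ dist G v x
      climb≤vx = +-cancelʳ-≤ (ecc G u) _ _ (begin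
        ℓ + ecc G u           ≡⟨ +-comm ℓ _ ⟩
        ecc G u + ℓ           ≤⟨ climb ⟩
        ecc G v               ≤⟨ ecc-lipschitz v x ⟩
        dist G v x + ecc G x  ≤⟨ +-monoʳ-≤ (dist G v x) ex≤eu ⟩
        dist G v x + ecc G u  ∎)

      twice-climb≤h : ∀ {X E} → ℓ ≤ X → E ≤ ecc G u → X + ecc G v ≤ E + h → 2 * ℓ ≤ h
      twice-climb≤h {X} {E} ℓ≤X E≤eu le = +-cancelˡ-≤ (ecc G u) _ _ (begin
        ecc G u + 2 * ℓ      ≡⟨ cong (λ m → ecc G u + (ℓ + m)) (+-identityʳ ℓ) ⟩
        ecc G u + (ℓ + ℓ)    ≡⟨ +-assoc (ecc G u) ℓ ℓ ⟨
        ecc G u + ℓ + ℓ      ≤⟨ +-mono-≤ climb ℓ≤X ⟩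
        ecc G v + X          ≡⟨ +-comm (ecc G v) X ⟩
        X + ecc G v          ≤⟨ le ⟩
        E + h                ≤⟨ +-monoˡ-≤ h E≤eu ⟩
        ecc G u + h          ∎)

module Geodesic (G : Graph) (P : ℕ → Fin (Graph.n G)) (p : ℕ)
                (geodesic : IsShortestPath G P p (P 0) (P p)) where
  open Distance G

  walk-along : ∀ a s → a + s ≤ p → Walk G (P a) (P (a + s)) s
  walk-along a zero    _   rewrite +-identityʳ a = here
  walk-along a (suc s) a+s<p rewrite +-suc a s =
    step (proj₁ (proj₂ (proj₂ geodesic)) a (≤-trans (s≤s (m≤m+n a s)) a+s<p)) (walk-along (suc a) s a+s<p)

  dist-along-≤ : ∀ {a b} → a ≤ b → b ≤ p → dist G (P a) (P b) ≤ b ∸ a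
  dist-along-≤ {a} {b} a≤b b≤p =
    subst (λ c → dist G (P a) (P c) ≤ b ∸ a) (m+[n∸m]≡n a≤b)
          (dist-≤-walk (walk-along a (b ∸ a) (subst (_≤ p) (sym (m+[n∸m]≡n a≤b)) b≤p)))

  -- Were P a and P b closer than b ∸ a, the detour through them would beat d(P 0, P p) = p.
  dist-along : ∀ {a b} → a ≤ b → b ≤ p → dist G (P a) (P b) ≡ b ∸ a
  dist-along {a} {b} a≤b b≤p = ≤-antisym (dist-along-≤ a≤b b≤p)
    (+-cancelʳ-≤ (p ∸ b) _ _ (+-cancelˡ-≤ a _ _ (begin
      a + (b ∸ a + (p ∸ b))              ≡⟨ +-assoc a _ _ ⟨
      a + (b ∸ a) + (p ∸ b)              ≡⟨ cong (_+ (p ∸ b)) (m+[n∸m]≡n a≤b) ⟩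
      b + (p ∸ b)                        ≡⟨ m+[n∸m]≡n b≤p ⟩
      p                                  ≡⟨ proj₂ (proj₂ (proj₂ geodesic)) ⟩
      dist G (P 0) (P p)                 ≤⟨ dist-triangle (P 0) (P a) (P p) ⟩
      dist G (P 0) (P a) + dist G (P a) (P p)
                                         ≤⟨ +-mono-≤ (dist-along-≤ z≤n (≤-trans a≤b b≤p))
                                                     (dist-triangle (P a) (P b) (P p)) ⟩
      a + (D + dist G (P b) (P p))       ≤⟨ +-monoʳ-≤ a (+-monoʳ-≤ D (dist-along-≤ b≤p ≤-refl)) ⟩
      a + (D + (p ∸ b))                  ∎)))
    where D = dist G (P a) (P b)

  dist-run : ∀ {i ℓ} → i + ℓ ≤ p → dist G (P i) (P (i + ℓ)) ≡ ℓ
  dist-run {i} {ℓ} i+ℓ≤p = trans (dist-along (m≤m+n i ℓ) i+ℓ≤p) (m+n∸m≡n i ℓ)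

  geodesic-split : ∀ {a b} → a ≤ b → b ≤ p →
                   dist G (P a) (P p) ≡ dist G (P a) (P b) + dist G (P b) (P p)
  geodesic-split {a} {b} a≤b b≤p = begin-equality
    dist G (P a) (P p)                      ≡⟨ dist-along (≤-trans a≤b b≤p) ≤-refl ⟩
    p ∸ a                                   ≡⟨ cong (_∸ a) (m+[n∸m]≡n b≤p) ⟨
    b + (p ∸ b) ∸ a                         ≡⟨ +-∸-comm (p ∸ b) a≤b ⟩
    b ∸ a + (p ∸ b)                         ≡⟨ cong₂ _+_ (dist-along a≤b b≤p) (dist-along b≤p ≤-refl) ⟨
    dist G (P a) (P b) + dist G (P b) (P p) ∎

module EndMinimalGeodesic (G : Graph) {h : ℕ} (H : Hyperbolic G h) (P : ℕ → Fin (Graph.n G)) (p : ℕ)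
                          (geodesic : IsShortestPath G P p (P 0) (P p)) (end-minimal : EndMinimal G P p) where
  open Distance G
  open Geodesic G P p geodesic

  up-hill-height : ∀ {i ℓ} → UpHill G P p i ℓ → 2 * dist G (P i) (P (i + ℓ)) ≤ h
  up-hill-height {i} {ℓ} (i+ℓ≤p , increasing , _) =
    ecc-ascent-bound H (geodesic-split (m≤m+n i ℓ) i+ℓ≤p) (end-minimal i (m+n≤o⇒m≤o i i+ℓ≤p))
      (subst (λ m → ecc G (P i) + m ≤ ecc G (P (i + ℓ))) (sym (dist-run i+ℓ≤p))
             (strictly-increasing⇒+-≤ (ecc G ∘ P) i ℓ increasing))

  ecc-descent-along : ∀ {a b} → a ≤ b → b ≤ p → h < dist G (P b) (P p) →
                      ecc G (P b) + dist G (P b) (P a) ≤ ecc G (P a) + h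
  ecc-descent-along a≤b b≤p = ecc-descent H (geodesic-split a≤b b≤p) (end-minimal _ b≤p)

  ecc-strict-descent : ∀ {a b} → a + (h + 1) ≤ b → b + (h + 1) ≤ p → ecc G (P b) < ecc G (P a)
  ecc-strict-descent {a} {b} a-far b-far =
    m+n≤o+h∧h<n⇒m<o (subst (h <_) (sym dist-ba) (m+[h+1]≤n⇒h<n∸m a a-far))
                    (ecc-descent-along a≤b b≤p (subst (h <_) (sym (dist-along b≤p ≤-refl)) (m+[h+1]≤n⇒h<n∸m b b-far)))
    where
    a≤b = m+n≤o⇒m≤o a a-far
    b≤p = m+n≤o⇒m≤o b b-far
    dist-ba : dist G (P b) (P a) ≡ b ∸ a
    dist-ba = trans (dist-sym (P b) (P a)) (dist-along a≤b b≤p)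

theorem17 : (G : Graph) → Connected G → (h : ℕ) → Hyperbolic G h →
    (y x : Fin (Graph.n G)) (P : ℕ → Fin (Graph.n G)) (p : ℕ) →
    IsShortestPath G P p y x → EndMinimal G P p →
    ((i ℓ : ℕ) → UpHill G P p i ℓ →
        ℓ ≡ dist G (P i) (P (i + ℓ)) × 2 * dist G (P i) (P (i + ℓ)) ≤ h)
    × ((j : ℕ) → j ≤ p → h < dist G (P j) x →
        (2 * ecc G (P j) ≤ 2 * ecc G y + h)
        × (ecc G (P j) + dist G (P j) y ≤ ecc G y + h))
    × (2 * h + 1 < dist G y x →
        (i : ℕ) → h + 1 ≤ i → i + h + 1 ≤ p →
        (k : ℕ) → k ≤ i ∸ (h + 1) → ecc G (P i) < ecc G (P k))
theorem17 G _ h H _ _ P p geodesic@(refl , refl , _) end-minimal =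
    (λ i ℓ up-hill → sym (dist-run (proj₁ up-hill)) , up-hill-height up-hill)
  , (λ j j≤p far → let descent = ecc-descent-along z≤n j≤p far in
       m+n≤o+h∧m≤n+o⇒2m≤2o+h _ _ _ h descent (ecc-lipschitz (P j) (P 0)) , descent)
  , λ _ i h+1≤i i+h+1≤p k k≤i∸[h+1] →
       ecc-strict-descent (m≤o∸n⇒m+n≤o k h+1≤i k≤i∸[h+1]) (subst (_≤ p) (+-assoc i h 1) i+h+1≤p)
  where
  open Distance G
  open Geodesic G P p geodesic
  open EndMinimalGeodesic G H P p geodesic end-minimal
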